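{- For all $y,z\in\{0,1\}^V$ with $y<_c z$ and every $d\in\{1,\dots,V\}$, $f^{\mathrm{LRU}}(y,d)\le_c f^{\mathrm{LRU}}(z,d)$.
   Context: A vector $x\in\{0,1\}^V$ encodes a buffer state: $x(j)=1$ iff the item at LRU stack depth $j$ is in the buffer. For $d\in\{1,\dots,V\}$, $R_d(x)=(x(d),x(1),\dots,x(d-1),x(d+1),\dots,x(V))$ (unit right cyclic shift of the length-$d$ prefix). The LRU transition $f^{\mathrm{LRU}}(x,d)$: if $x(d)=1$ (hit), it is $R_d(x)$; if $x(d)=0$ (miss), let $y=R_d(x)$ and $m=\max\{j:y(j)=1\}$; then $f^{\mathrm{LRU}}(x,d)$ is $y$ with $y(m)$ set to $0$ and $y(1)$ set to $1$. Critical pair: $y<_c z$ if, as strings, $y=1\nu1\iota0\sigma$ and $z=1\nu0\iota1\sigma$ for arbitrary binary strings $\nu,\iota$ and $\sigma\in0^*$; $y\le_c z$ means $y=z$ or $y<_c z$. -}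

module Defs where

open import Data.Bool using (Bool; true; false; if_then_else_)
open import Data.List using (List; []; _∷_; _++_; take; drop; length; replicate)
open import Data.Nat using (ℕ; zero; suc; _∸_; _≤_)
open import Data.Product using (Σ; ∃; _×_; _,_)
open import Data.Sum using (_⊎_)
open import Relation.Binary.PropositionalEquality using (_≡_)

-- A buffer state x ∈ {0,1}^V is a list of booleans of length V;
-- position j (1-indexed) of the list is x(j); true = 1, false = 0.

-- x(j), 1-indexed; out-of-range positions read as 0 (never used for 1 ≤ j ≤ V).
at : List Bool → ℕ → Bool
at []       _             = false
at (b ∷ bs) zero          = false
at (b ∷ bs) (suc zero)    = b
at (b ∷ bs) (suc (suc j)) = at bs (suc j)

R : ℕ → List Bool → List Bool
R d x = at x d ∷ (take (d ∸ 1) x ++ drop d x)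

-- set the last 1 of a string to 0 (i.e. y(m) := 0 with m = max{j : y(j) = 1});
-- leaves an all-zero string unchanged.
anyTrue : List Bool → Bool
anyTrue []           = false
anyTrue (true ∷ _)   = true
anyTrue (false ∷ bs) = anyTrue bs

clearLast : List Bool → List Bool
clearLast []           = []
clearLast (b ∷ bs) with anyTrue bs
... | true  = b ∷ clearLast bs
... | false = false ∷ bs

setFirst : List Bool → List Bool
setFirst []       = []
setFirst (_ ∷ bs) = true ∷ bs

fLRU : List Bool → ℕ → List Bool
fLRU x d with at x d
... | true  = R d x
... | false = setFirst (clearLast (R d x))

_<c_ : List Bool → List Bool → Set
y <c z = Σ (List Bool) λ ν → Σ (List Bool) λ ι → Σ ℕ λ k →
  (y ≡ true ∷ ν ++ true ∷ ι ++ false ∷ replicate k false) ×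
  (z ≡ true ∷ ν ++ false ∷ ι ++ true ∷ replicate k false)

_≤c_ : List Bool → List Bool → Set
y ≤c z = (y ≡ z) ⊎ (y <c z)

-- Write a critical pair as y = a 1 ι 0 σ, z = a 0 ι 1 σ with σ ∈ 0*, the differing
-- positions being p = |a| + 1 and q = p + |ι| + 1.  If the requested depth d avoids
-- p and q, both states request the same bit and R_d keeps the differing bits in
-- corresponding places behind the moved item.  A common hit then gives a critical
-- pair outright; a common miss evicts the 1 at q in z and, in y, the last 1 of ι or
-- the 1 at p if ι has none, giving a critical pair or equal states.  At d = p, y hits
-- while z misses and evicts its 1 at q, so both become 1 a ι 0 σ; at d = q, z hits
-- and y misses, evicting as before.
module Submission where

open import Defs
open import Data.Bool using (Bool; true; false)
open import Data.List using (List; []; _∷_; _++_; take; drop; length; replicate)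
open import Data.List.Properties using (++-assoc; ∷-injective)
open import Data.Nat using (ℕ; zero; suc; _+_; _∸_; _≤_; z≤n; s≤s)
open import Data.Product using (∃; _,_)
open import Data.Sum using (inj₁; inj₂)
open import Relation.Binary.PropositionalEquality
  using (_≡_; refl; sym; trans; cong; cong₂; subst; subst₂; module ≡-Reasoning)

zeros : ℕ → List Bool
zeros k = replicate k false

replicate-++ : ∀ {A : Set} m n (x : A) → replicate m x ++ replicate n x ≡ replicate (m + n) x
replicate-++ zero    n x = refl
replicate-++ (suc m) n x = cong (x ∷_) (replicate-++ m n x)

++-∷-zeros : ∀ u b m k → (u ++ b ∷ zeros m) ++ zeros k ≡ u ++ b ∷ zeros (m + k)
++-∷-zeros u b m k = trans (++-assoc u (b ∷ zeros m) (zeros k))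
                           (cong (λ t → u ++ b ∷ t) (replicate-++ m k false))

removeAt : ℕ → List Bool → List Bool
removeAt d x = take (d ∸ 1) x ++ drop d x

data Position (P : List Bool) : ℕ → Set where
  inside : ∀ {d} → d ≤ length P → Position P d
  beyond : ∀ e → Position P (suc (length P + e))

position : ∀ P d → Position P d
position P       zero    = inside z≤n
position []      (suc d) = beyond d
position (p ∷ P) (suc d) with position P d
... | inside d≤ = inside (s≤s d≤)
... | beyond e  = beyond e

at-zero : ∀ x → at x 0 ≡ false
at-zero []      = refl
at-zero (_ ∷ _) = refl

at-++ˡ : ∀ P r {d} → d ≤ length P → at (P ++ r) d ≡ at P d
at-++ˡ []      r z≤n                    = at-zero r
at-++ˡ (p ∷ P) r z≤n                    = refl
at-++ˡ (p ∷ P) r {suc zero} _           = refl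
at-++ˡ (p ∷ P) r {suc (suc d)} (s≤s d≤) = at-++ˡ P r d≤

removeAt-++ˡ : ∀ P r {d} → d ≤ length P → removeAt d (P ++ r) ≡ removeAt d P ++ r
removeAt-++ˡ []      r z≤n                    = refl
removeAt-++ˡ (p ∷ P) r z≤n                    = refl
removeAt-++ˡ (p ∷ P) r {suc zero} _           = refl
removeAt-++ˡ (p ∷ P) r {suc (suc d)} (s≤s d≤) = cong (p ∷_) (removeAt-++ˡ P r d≤)

R-++ˡ : ∀ P r {d} → d ≤ length P → R d (P ++ r) ≡ at P d ∷ removeAt d P ++ r
R-++ˡ P r d≤ = cong₂ _∷_ (at-++ˡ P r d≤) (removeAt-++ˡ P r d≤)

at-++ʳ : ∀ P r e → at (P ++ r) (suc (length P + e)) ≡ at r (suc e)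
at-++ʳ []      r e = refl
at-++ʳ (p ∷ P) r e = at-++ʳ P r e

removeAt-++ʳ : ∀ P r e → removeAt (suc (length P + e)) (P ++ r) ≡ P ++ removeAt (suc e) r
removeAt-++ʳ []      r e = refl
removeAt-++ʳ (p ∷ P) r e = cong (p ∷_) (removeAt-++ʳ P r e)

R-++ʳ : ∀ P r e → R (suc (length P + e)) (P ++ r) ≡ at r (suc e) ∷ P ++ removeAt (suc e) r
R-++ʳ P r e = cong₂ _∷_ (at-++ʳ P r e) (removeAt-++ʳ P r e)

R-++-behind : ∀ a b s {m h t} → R (suc m) s ≡ h ∷ t →
              R (suc (length a + suc m)) (a ++ b ∷ s) ≡ h ∷ a ++ b ∷ t
R-++-behind a b s {m} eq with ∷-injective eq
... | at≡ , rest≡ =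
  trans (R-++ʳ a (b ∷ s) (suc m)) (cong₂ _∷_ at≡ (cong (λ t → a ++ b ∷ t) rest≡))

R-zeros : ∀ n k → ∃ λ k′ → R n (zeros k) ≡ false ∷ zeros k′
R-zeros zero          k       = k , cong (_∷ zeros k) (at-zero (zeros k))
R-zeros (suc zero)    zero    = 0 , refl
R-zeros (suc zero)    (suc k) = k , refl
R-zeros (suc (suc n)) zero    = 0 , refl
R-zeros (suc (suc n)) (suc k) with R-zeros (suc n) k
... | k′ , eq = suc k′ , R-++-behind [] false (zeros k) eq

anyTrue-++ : ∀ u {s} → anyTrue s ≡ true → anyTrue (u ++ s) ≡ true
anyTrue-++ []          h = h
anyTrue-++ (true ∷ u)  h = refl
anyTrue-++ (false ∷ u) h = anyTrue-++ u h

anyTrue-zeros : ∀ k → anyTrue (zeros k) ≡ false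
anyTrue-zeros zero    = refl
anyTrue-zeros (suc k) = anyTrue-zeros k

clearLast-++ : ∀ u {s} → anyTrue s ≡ true → clearLast (u ++ s) ≡ u ++ clearLast s
clearLast-++ []      h = refl
clearLast-++ (b ∷ u) {s} h with anyTrue (u ++ s) | anyTrue-++ u {s} h
... | true | refl = cong (b ∷_) (clearLast-++ u h)

clearLast-trailing : ∀ k → clearLast (true ∷ zeros k) ≡ false ∷ zeros k
clearLast-trailing k rewrite anyTrue-zeros k = refl

clearLast-last : ∀ u v k → clearLast (u ++ v ++ true ∷ zeros k) ≡ u ++ v ++ false ∷ zeros k
clearLast-last u v k = begin
  clearLast (u ++ v ++ true ∷ zeros k)  ≡⟨ clearLast-++ u (anyTrue-++ v refl) ⟩
  u ++ clearLast (v ++ true ∷ zeros k)  ≡⟨ cong (u ++_) (clearLast-++ v refl) ⟩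
  u ++ v ++ clearLast (true ∷ zeros k)  ≡⟨ cong (λ t → u ++ v ++ t) (clearLast-trailing k) ⟩
  u ++ v ++ false ∷ zeros k             ∎
  where open ≡-Reasoning

fetchFront : List Bool → List Bool
fetchFront []           = []
fetchFront (true ∷ xs)  = true ∷ xs
fetchFront (false ∷ xs) = setFirst (clearLast (false ∷ xs))

fLRU-fetchFront : ∀ x d → fLRU x d ≡ fetchFront (R d x)
fLRU-fetchFront x d with at x d in eq
... | true  = cong (_∷ removeAt d x) eq
... | false = cong (λ b → setFirst (clearLast (b ∷ removeAt d x))) eq

data LastOne : List Bool → Set where
  none : ∀ n → LastOne (zeros n)
  last : ∀ ι m → LastOne (ι ++ true ∷ zeros m)

lastOne : ∀ ι → LastOne ι
lastOne []      = none 0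
lastOne (b ∷ ι) with lastOne ι
lastOne (false ∷ .(zeros n))            | none n   = none (suc n)
lastOne (true  ∷ .(zeros n))            | none n   = last [] n
lastOne (b     ∷ .(ι ++ true ∷ zeros m)) | last ι m = last (b ∷ ι) m

fetchFront-evict-≤c : ∀ w ι k →
  fetchFront (false ∷ w ++ true ∷ ι ++ zeros k) ≤c (true ∷ w ++ false ∷ ι ++ zeros k)
fetchFront-evict-≤c w ι k with lastOne ι
... | none n = inj₁ (begin
  setFirst (clearLast (false ∷ w ++ true ∷ zeros n ++ zeros k))
    ≡⟨ cong (λ t → setFirst (clearLast (false ∷ w ++ true ∷ t))) (replicate-++ n k false) ⟩
  setFirst (clearLast (false ∷ w ++ [] ++ true ∷ zeros (n + k)))
    ≡⟨ cong setFirst (clearLast-last (false ∷ w) [] (n + k)) ⟩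
  true ∷ w ++ false ∷ zeros (n + k)
    ≡⟨ cong (λ t → true ∷ w ++ false ∷ t) (replicate-++ n k false) ⟨
  true ∷ w ++ false ∷ zeros n ++ zeros k ∎)
  where open ≡-Reasoning
... | last ι′ m =
  inj₂ (w , ι′ , m + k , evicted , cong (λ t → true ∷ w ++ false ∷ t) (++-∷-zeros ι′ true m k))
  where
  open ≡-Reasoning
  evicted : fetchFront (false ∷ w ++ true ∷ (ι′ ++ true ∷ zeros m) ++ zeros k)
          ≡ true ∷ w ++ true ∷ ι′ ++ false ∷ zeros (m + k)
  evicted = begin
    setFirst (clearLast (false ∷ w ++ true ∷ (ι′ ++ true ∷ zeros m) ++ zeros k))
      ≡⟨ cong (λ t → setFirst (clearLast (false ∷ w ++ true ∷ t))) (++-∷-zeros ι′ true m k) ⟩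
    setFirst (clearLast (false ∷ w ++ (true ∷ ι′) ++ true ∷ zeros (m + k)))
      ≡⟨ cong setFirst (clearLast-last (false ∷ w) (true ∷ ι′) (m + k)) ⟩
    true ∷ w ++ true ∷ ι′ ++ false ∷ zeros (m + k) ∎

fetchFront-agree-≤c : ∀ b w ι k →
  fetchFront (b ∷ w ++ true ∷ ι ++ false ∷ zeros k) ≤c
  fetchFront (b ∷ w ++ false ∷ ι ++ true ∷ zeros k)
fetchFront-agree-≤c true  w ι k = inj₂ (w , ι , k , refl , refl)
fetchFront-agree-≤c false w ι k =
  subst (fetchFront (false ∷ w ++ true ∷ ι ++ false ∷ zeros k) ≤c_)
        (sym (cong setFirst (clearLast-last (false ∷ w) (false ∷ ι) k)))
        (fetchFront-evict-≤c w ι (suc k))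

fetchFront-hit≡miss : ∀ a ι k →
  fetchFront (true ∷ a ++ ι ++ false ∷ zeros k) ≡ fetchFront (false ∷ a ++ ι ++ true ∷ zeros k)
fetchFront-hit≡miss a ι k = sym (cong setFirst (clearLast-last (false ∷ a) ι k))

fLRU-≤c : ∀ {y z u v} d → R d y ≡ u → R d z ≡ v →
          fetchFront u ≤c fetchFront v → fLRU y d ≤c fLRU z d
fLRU-≤c {y} {z} d Ry≡u Rz≡v =
  subst₂ _≤c_ (sym (trans (fLRU-fetchFront y d) (cong fetchFront Ry≡u)))
              (sym (trans (fLRU-fetchFront z d) (cong fetchFront Rz≡v)))

data Depth (a ι : List Bool) : ℕ → Set where
  in-prefix : ∀ {d} → d ≤ length a → Depth a ι d
  at-first  : Depth a ι (suc (length a + 0))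
  in-middle : ∀ {j} → suc j ≤ length ι → Depth a ι (suc (length a + suc j))
  at-second : Depth a ι (suc (length a + suc (length ι + 0)))
  in-tail   : ∀ t → Depth a ι (suc (length a + suc (length ι + suc t)))

depth : ∀ a ι d → Depth a ι d
depth a ι d with position a d
depth a ι d                         | inside d≤      = in-prefix d≤
depth a ι .(suc (length a + 0))     | beyond zero    = at-first
depth a ι .(suc (length a + suc j)) | beyond (suc j) with position ι (suc j)
... | inside j≤ = in-middle j≤
depth a ι .(suc (length a + suc (length ι + 0)))
  | beyond (suc .(length ι + 0))     | beyond zero    = at-second
depth a ι .(suc (length a + suc (length ι + suc t)))
  | beyond (suc .(length ι + suc t)) | beyond (suc t) = in-tail t

fLRU-critical-pair : ∀ a ι k d →
  fLRU (a ++ true ∷ ι ++ false ∷ zeros k) d ≤c fLRU (a ++ false ∷ ι ++ true ∷ zeros k) d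
fLRU-critical-pair a ι k d with depth a ι d
... | in-prefix d≤ =
  fLRU-≤c d (R-++ˡ a _ d≤) (R-++ˡ a _ d≤) (fetchFront-agree-≤c (at a d) (removeAt d a) ι k)
... | at-first =
  fLRU-≤c d (R-++ʳ a _ 0) (R-++ʳ a _ 0) (inj₁ (fetchFront-hit≡miss a ι k))
... | in-middle {j} j≤ =
  fLRU-≤c d (R-++-behind a true _ (R-++ˡ ι _ j≤)) (R-++-behind a false _ (R-++ˡ ι _ j≤))
          (fetchFront-agree-≤c (at ι (suc j)) a (removeAt (suc j) ι) k)
... | at-second =
  fLRU-≤c d (R-++-behind a true _ (R-++ʳ ι _ 0)) (R-++-behind a false _ (R-++ʳ ι _ 0))
          (fetchFront-evict-≤c a ι k)
... | in-tail t with R-zeros (suc t) k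
...   | k′ , Rσ≡ =
  fLRU-≤c d (R-++-behind a true _ (R-++-behind ι false _ Rσ≡))
            (R-++-behind a false _ (R-++-behind ι true _ Rσ≡))
            (fetchFront-agree-≤c false a ι k′)

lemma4 : (V : ℕ) (y z : List Bool) → length y ≡ V → length z ≡ V →
         y <c z → (d : ℕ) → 1 ≤ d → d ≤ V →
         fLRU y d ≤c fLRU z d
lemma4 _ _ _ _ _ (ν , ι , k , refl , refl) d _ _ = fLRU-critical-pair (true ∷ ν) ι k d
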